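{- For $n\ge 0$, let $q_n$ be the number of permutations of $\{1,\dots,n\}$ that avoid each of the patterns $2143$, $2413$ and $3142$. Define a sequence $(r_n)_{n\ge 0}$ by $r_0=r_1=1$ and, for $n>1$, $$r_n=\sum_{i=1}^{n-1}\sum_{j=i+1}^{n} r_{i-1}\,r_{j-i-1}\,r_{n-j}.$$ Then $q_n\ge r_n$ for all $n\ge 0$.
   Context: A permutation $\pi$ of length $n$ contains a pattern $\sigma$ of length $k$ if some subsequence of $\pi$ (of length $k$) is order-isomorphic to $\sigma$; otherwise $\pi$ avoids $\sigma$. The empty permutation is the unique permutation of length $0$. -}

module Defs where

open import Data.Nat using (ℕ; zero; suc; _+_; _*_; _∸_)
open import Data.Fin using (Fin; zero; suc; _<_)
open import Data.Fin.Permutation using (Permutation′; _⟨$⟩ʳ_)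
open import Data.List using (List; []; _∷_; _++_; map; applyUpTo)
open import Data.Nat.ListAction using (sum)
open import Data.Product using (Σ; _×_; ∃)
open import Function.Bundles using (_⇔_)
open import Data.Empty using (⊥)
open import Relation.Binary.PropositionalEquality using (_≡_)
open import Data.Product using (_,_)

-- A permutation of length n is a bijection of Fin n = {0,…,n-1}
-- (the 0-based version of {1,…,n}).
Perm : ℕ → Set
Perm n = Permutation′ n

Contains : {n k : ℕ} → (Fin n → Fin n) → (Fin k → Fin k) → Set
Contains {n} {k} π σ =
  Σ (Fin k → Fin n) λ ι →
    (∀ a b → a < b → ι a < ι b) ×
    (∀ a b → (π (ι a) < π (ι b)) ⇔ (σ a < σ b))

Avoids : {n k : ℕ} → (Fin n → Fin n) → (Fin k → Fin k) → Set
Avoids π σ = Contains π σ → ⊥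

-- Patterns of length 4, in 0-based one-line notation.
-- 2143 ↦ 1 0 3 2
p2143 : Fin 4 → Fin 4
p2143 zero = suc zero
p2143 (suc zero) = zero
p2143 (suc (suc zero)) = suc (suc (suc zero))
p2143 (suc (suc (suc zero))) = suc (suc zero)

p2413 : Fin 4 → Fin 4
p2413 zero = suc zero
p2413 (suc zero) = suc (suc (suc zero))
p2413 (suc (suc zero)) = zero
p2413 (suc (suc (suc zero))) = suc (suc zero)

p3142 : Fin 4 → Fin 4
p3142 zero = suc (suc zero)
p3142 (suc zero) = zero
p3142 (suc (suc zero)) = suc (suc (suc zero))
p3142 (suc (suc (suc zero))) = suc zero

AvoidingPerm : ℕ → Set
AvoidingPerm n =
  Σ (Perm n) λ π →
    Avoids (π ⟨$⟩ʳ_) p2143 × Avoids (π ⟨$⟩ʳ_) p2413 × Avoids (π ⟨$⟩ʳ_) p3142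

SamePerm : {n : ℕ} → AvoidingPerm n → AvoidingPerm n → Set
SamePerm {n} (π , _) (τ , _) = ∀ (i : Fin n) → π ⟨$⟩ʳ i ≡ τ ⟨$⟩ʳ i

-- [ a ⋯ b ] = the list a, a+1, …, b (empty if b < a).
[_⋯_] : ℕ → ℕ → List ℕ
[ a ⋯ b ] = applyUpTo (a +_) (suc b ∸ a)

-- Lookup in a list with default 0 (only used at in-range indices).
at : List ℕ → ℕ → ℕ
at []       _       = 0
at (x ∷ xs) zero    = x
at (x ∷ xs) (suc k) = at xs k

-- r-step n t : the value r_n computed from t k = r_k for k < n.
r-step : ℕ → (ℕ → ℕ) → ℕ
r-step zero          t = 1
r-step (suc zero)    t = 1
r-step n@(suc (suc _)) t =
  sum (map (λ i → sum (map (λ j → t (i ∸ 1) * t (j ∸ i ∸ 1) * t (n ∸ j))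
                           [ suc i ⋯ n ]))
           [ 1 ⋯ n ∸ 1 ])

-- r-table n = [ r_0 , … , r_{n-1} ].
r-table : ℕ → List ℕ
r-table zero    = []
r-table (suc n) = r-table n ++ (r-step n (at (r-table n)) ∷ [])

r : ℕ → ℕ
r n = at (r-table (suc n)) n

module Submission where

-- q_n ≥ r_n, proved by exhibiting r_n distinct permutations of length n that avoid 132.
-- Each of 2143, 2413, 3142 contains 132 (as 1_43, 2_4_3, 1_4_2 respectively), so every
-- 132-avoider avoids all three patterns.
--
-- 1. The recursion for r is brought into block form
--      r_{m+2} = Σ_{k ≤ m} Σ_{l ≤ m-k} r_k r_l r_{m-k-l}      (r-recursion).
-- 2. This counts ternary nodes node A (node B C) with |A| = k, |B| = l, |C| = m-k-l:
--    splitting Fin of a sum into blocks (glue) and Fin of a product into digits, an index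
--    below r_n is encoded injectively as a binary tree with n nodes (encode); the block
--    indices k and l are recovered as subtree sizes.
-- 3. A binary tree node α β yields the permutation (α shifted up by |β|) , max , β
--    (the skew sum); it preserves bijectivity and 132-avoidance, and the tree is read back
--    from the position of the maximum, so treePerm is injective.
-- 4. Composing 2 and 3 and transporting to Fin-permutations gives the theorem.

open import Defs
open import Data.Nat using (ℕ; zero; suc; pred; _+_; _*_; _∸_; _≤_; _<_; z≤n; s≤s; s≤s⁻¹)
open import Data.Nat.Properties
open import Data.List using (List; []; _∷_; _++_; map; applyUpTo; length)
open import Data.List.Properties using (length-++; map-applyUpTo)
open import Data.Nat.ListAction using (sum)
open import Data.Empty using (⊥; ⊥-elim)
open import Relation.Nullary using (yes; no)
open import Data.Fin using (Fin; toℕ; fromℕ<; splitAt; join; remQuot; combine)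
open import Data.Fin.Patterns using (0F; 1F; 2F; 3F)
open import Data.Fin.Properties using (join-splitAt; combine-remQuot; toℕ<n; toℕ-fromℕ<; toℕ-injective)
open import Data.Sum using (inj₁; inj₂; [_,_]′)
open import Data.Product using (Σ; _×_; _,_; proj₁; proj₂; map₁)
open import Function.Definitions using (Injective)
open import Function.Bundles using (Equivalence)
open import Data.Fin.Permutation using (permutation)
open import Relation.Binary.PropositionalEquality
open import Relation.Binary.PropositionalEquality.Properties using (subst-injective)
open import Relation.Binary.Definitions using (tri<; tri≈; tri>)

at-++ˡ : ∀ (xs ys : List ℕ) k → k < length xs → at (xs ++ ys) k ≡ at xs k
at-++ˡ (x ∷ xs) ys zero    _   = refl
at-++ˡ (x ∷ xs) ys (suc k) k<n = at-++ˡ xs ys k (s≤s⁻¹ k<n)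

at-last : ∀ (xs : List ℕ) y → at (xs ++ y ∷ []) (length xs) ≡ y
at-last []       y = refl
at-last (x ∷ xs) y = at-last xs y

length-r-table : ∀ n → length (r-table n) ≡ n
length-r-table zero    = refl
length-r-table (suc n) = begin
  length (r-table n ++ _ ∷ [])  ≡⟨ length-++ (r-table n) ⟩
  length (r-table n) + 1        ≡⟨ +-comm (length (r-table n)) 1 ⟩
  suc (length (r-table n))      ≡⟨ cong suc (length-r-table n) ⟩
  suc n                         ∎
  where open ≡-Reasoning

at-r-table : ∀ n k → k < n → at (r-table n) k ≡ r k
at-r-table (suc n) k k<1+n with <-cmp k n
... | tri< k<n _ _ = trans (at-++ˡ (r-table n) _ k (subst (k <_) (sym (length-r-table n)) k<n))
                           (at-r-table n k k<n)
... | tri≈ _ refl _ = refl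
... | tri> _ _ n<k = ⊥-elim (<⇒≱ n<k (s≤s⁻¹ k<1+n))

r-unfold : ∀ n → r n ≡ r-step n (at (r-table n))
r-unfold n = subst (λ i → at (r-table n ++ r-step n (at (r-table n)) ∷ []) i ≡ r-step n (at (r-table n)))
                   (length-r-table n) (at-last (r-table n) _)

applyUpTo-cong : ∀ {A : Set} (f g : ℕ → A) n → (∀ i → i < n → f i ≡ g i) → applyUpTo f n ≡ applyUpTo g n
applyUpTo-cong f g zero    _  = refl
applyUpTo-cong f g (suc n) eq =
  cong₂ _∷_ (eq 0 (s≤s z≤n))
            (applyUpTo-cong (λ i → f (suc i)) (λ i → g (suc i)) n (λ i i<n → eq (suc i) (s≤s i<n)))

Block : (ℕ → ℕ) → ℕ → ℕ → ℕ → ℕ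
Block t m k l = t k * t l * t (m ∸ k ∸ l)

Inner : (ℕ → ℕ) → ℕ → ℕ → ℕ
Inner t m k = sum (applyUpTo (Block t m k) (suc m ∸ k))

Outer : (ℕ → ℕ) → ℕ → ℕ
Outer t m = sum (applyUpTo (Inner t m) (suc m))

-- Substituting i = k + 1 and j = k + l + 2 turns the defining double sum into Outer.
r-step-reindex : ∀ t m → r-step (suc (suc m)) t ≡ Outer t m
r-step-reindex t m =
  cong sum (trans (map-applyUpTo suc _ (suc m)) (applyUpTo-cong _ _ (suc m) (λ k _ → inner k)))
  where
  j-index : ∀ k l → suc (suc (k + l)) ∸ suc k ∸ 1 ≡ l
  j-index zero    l = refl
  j-index (suc k) l = j-index k l

  inner : ∀ k → sum (map (λ j → t k * t (j ∸ suc k ∸ 1) * t (suc (suc m) ∸ j)) [ suc (suc k) ⋯ suc (suc m) ])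
              ≡ Inner t m k
  inner k = cong sum (trans (map-applyUpTo (suc (suc k) +_) _ (suc m ∸ k))
    (applyUpTo-cong _ _ (suc m ∸ k) (λ l _ →
      cong₂ (λ x y → t k * t x * t y) (j-index k l) (sym (∸-+-assoc m k l)))))

block-bound : ∀ {m k l} → k ≤ m → l < suc m ∸ k → l ≤ m ∸ k
block-bound {m} {k} {l} k≤m l< = s≤s⁻¹ (subst (l <_) (+-∸-assoc 1 k≤m) l<)

Outer-cong : ∀ t u m → (∀ k → k ≤ m → t k ≡ u k) → Outer t m ≡ Outer u m
Outer-cong t u m eq = cong sum (applyUpTo-cong _ _ (suc m) λ k k<1+m →
  let k≤m = s≤s⁻¹ k<1+m in
  cong sum (applyUpTo-cong _ _ (suc m ∸ k) λ l l< →
    let l≤m-k = block-bound k≤m l< in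
    cong₂ _*_ (cong₂ _*_ (eq k k≤m) (eq l (≤-trans l≤m-k (m∸n≤m m k))))
              (eq (m ∸ k ∸ l) (≤-trans (m∸n≤m (m ∸ k) l) (m∸n≤m m k)))))

r-recursion : ∀ m → r (suc (suc m)) ≡ Outer r m
r-recursion m = begin
  r (suc (suc m))                        ≡⟨ r-unfold (suc (suc m)) ⟩
  r-step (suc (suc m)) table             ≡⟨ r-step-reindex table m ⟩
  Outer table m                          ≡⟨ Outer-cong table r m (λ k k≤m → at-r-table _ k (s≤s (m≤n⇒m≤1+n k≤m))) ⟩
  Outer r m                              ∎
  where
  open ≡-Reasoning
  table : ℕ → ℕ
  table = at (r-table (suc (suc m)))

retraction⇒injective : ∀ {A B : Set} (f : A → B) (g : B → A) → (∀ x → g (f x) ≡ x) → Injective _≡_ _≡_ f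
retraction⇒injective f g gf {x} {y} eq = trans (sym (gf x)) (trans (cong g eq) (gf y))

splitAt-injective : ∀ a {b} → Injective _≡_ _≡_ (splitAt a {b})
splitAt-injective a = retraction⇒injective (splitAt a) (join a _) (join-splitAt a _)

remQuot-injective : ∀ {a} b → Injective _≡_ _≡_ (remQuot {a} b)
remQuot-injective {a} b = retraction⇒injective (remQuot b) (λ p → combine (proj₁ p) (proj₂ p)) (combine-remQuot {a} b)

glue : {X : Set} (m : ℕ) (G : ℕ → ℕ) (H : ∀ k → Fin (G k) → X) → Fin (sum (applyUpTo G m)) → X
glue (suc m) G H x = [ H 0 , glue m (λ k → G (suc k)) (λ k → H (suc k)) ]′ (splitAt (G 0) x)

glue-preserves : {X : Set} (m : ℕ) (G : ℕ → ℕ) (H : ∀ k → Fin (G k) → X) (P : X → Set) →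
  (∀ k u → k < m → P (H k u)) → ∀ x → P (glue m G H x)
glue-preserves (suc m) G H P hP x with splitAt (G 0) x
... | inj₁ u = hP 0 u (s≤s z≤n)
... | inj₂ w = glue-preserves m _ (λ k → H (suc k)) P (λ k u k<m → hP (suc k) u (s≤s k<m)) w

glue-injective : {X : Set} (m : ℕ) (G : ℕ → ℕ) (H : ∀ k → Fin (G k) → X) (label : X → ℕ) →
  (∀ k u → k < m → label (H k u) ≡ k) → (∀ k → k < m → Injective _≡_ _≡_ (H k)) →
  Injective _≡_ _≡_ (glue m G H)
glue-injective {X} (suc m) G H label lab inj eq = splitAt-injective (G 0) (same-block _ _ eq)
  where
  G′ : ℕ → ℕ
  G′ k = G (suc k)
  H′ : ∀ k → Fin (G′ k) → X
  H′ k = H (suc k)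
  positive : ∀ w → 0 < label (glue m G′ H′ w)
  positive = glue-preserves m G′ H′ (λ t → 0 < label t)
    (λ k u k<m → subst (0 <_) (sym (lab (suc k) u (s≤s k<m))) (s≤s z≤n))
  same-block : ∀ s s′ → [ H 0 , glue m G′ H′ ]′ s ≡ [ H 0 , glue m G′ H′ ]′ s′ → s ≡ s′
  same-block (inj₁ u) (inj₁ u′) e = cong inj₁ (inj 0 (s≤s z≤n) e)
  same-block (inj₁ u) (inj₂ w′) e =
    ⊥-elim (<-irrefl (sym (lab 0 u (s≤s z≤n))) (subst (λ t → 0 < label t) (sym e) (positive w′)))
  same-block (inj₂ w) (inj₁ u′) e =
    ⊥-elim (<-irrefl (sym (lab 0 u′ (s≤s z≤n))) (subst (λ t → 0 < label t) e (positive w)))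
  same-block (inj₂ w) (inj₂ w′) e = cong inj₂
    (glue-injective m G′ H′ (λ t → pred (label t)) (λ k u k<m → cong pred (lab (suc k) u (s≤s k<m)))
                    (λ k k<m → inj (suc k) (s≤s k<m)) e)

digits : ∀ a b c → Fin (a * b * c) → (Fin a × Fin b) × Fin c
digits a b c v = map₁ (remQuot {a} b) (remQuot {a * b} c v)

digits-injective : ∀ a b c → Injective _≡_ _≡_ (digits a b c)
digits-injective a b c e =
  remQuot-injective {a * b} c (cong₂ _,_ (remQuot-injective {a} b (cong proj₁ e)) (cong proj₂ e))

data Tree : Set where
  leaf : Tree
  node : Tree → Tree → Tree

size : Tree → ℕ
size leaf       = 0
size (node α β) = suc (size α + size β)

left right : Tree → Tree
left  leaf       = leaf
left  (node α β) = α
right leaf       = leaf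
right (node α β) = β

tnode : Tree → Tree → Tree → Tree
tnode α β γ = node α (node β γ)

tnode-size : ∀ {m k l} (α β γ : Tree) → k ≤ m → l ≤ m ∸ k →
  size α ≡ k → size β ≡ l → size γ ≡ m ∸ k ∸ l → size (tnode α β γ) ≡ suc (suc m)
tnode-size {m} {k} {l} α β γ k≤m l≤m-k refl refl eγ = cong suc (begin
  k + suc (l + size γ)        ≡⟨ +-suc k _ ⟩
  suc (k + (l + size γ))      ≡⟨ cong (λ c → suc (k + (l + c))) eγ ⟩
  suc (k + (l + (m ∸ k ∸ l))) ≡⟨ cong (λ c → suc (k + c)) (m+[n∸m]≡n l≤m-k) ⟩
  suc (k + (m ∸ k))           ≡⟨ cong suc (m+[n∸m]≡n k≤m) ⟩
  suc m                       ∎)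
  where open ≡-Reasoning

-- One level of the encoding: an index below r_{m+2} = Outer r m selects a block (k , l)
-- and three digits, which E turns into the three subtrees of a ternary node.
module Step (m : ℕ) (E : (k : ℕ) → Fin (r k) → Tree) where

  cell : ∀ k l → Fin (Block r m k l) → Tree
  cell k l v = tnode (E k (proj₁ (proj₁ d))) (E l (proj₂ (proj₁ d))) (E (m ∸ k ∸ l) (proj₂ d))
    where
    d : (Fin (r k) × Fin (r l)) × Fin (r (m ∸ k ∸ l))
    d = digits (r k) (r l) (r (m ∸ k ∸ l)) v

  layer : ∀ k → Fin (Inner r m k) → Tree
  layer k = glue (suc m ∸ k) (Block r m k) (cell k)

  step : Fin (r (suc (suc m))) → Tree
  step x = glue (suc m) (Inner r m) layer (subst Fin (r-recursion m) x)

  private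
    bounds : ∀ {k l} → k < suc m → l < suc m ∸ k → k ≤ m × l ≤ m ∸ k
    bounds k<1+m l< = s≤s⁻¹ k<1+m , block-bound (s≤s⁻¹ k<1+m) l<

    l≤m : ∀ k {l} → l ≤ m ∸ k → l ≤ m
    l≤m k l≤m-k = ≤-trans l≤m-k (m∸n≤m m k)

    rest≤m : ∀ k l → m ∸ k ∸ l ≤ m
    rest≤m k l = ≤-trans (m∸n≤m (m ∸ k) l) (m∸n≤m m k)

  module _ (E-size : ∀ k → k ≤ m → ∀ i → size (E k i) ≡ k) where

    cell-size : ∀ k l v → k < suc m → l < suc m ∸ k → size (cell k l v) ≡ suc (suc m)
    cell-size k l v k< l< = let (k≤m , l≤m-k) = bounds k< l< in
      tnode-size _ _ _ k≤m l≤m-k (E-size k k≤m _) (E-size l (l≤m k l≤m-k) _) (E-size _ (rest≤m k l) _)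

    step-size : ∀ x → size (step x) ≡ suc (suc m)
    step-size x = glue-preserves (suc m) (Inner r m) layer (λ t → size t ≡ suc (suc m))
      (λ k u k< → glue-preserves (suc m ∸ k) (Block r m k) (cell k) (λ t → size t ≡ suc (suc m))
                    (λ l v l< → cell-size k l v k< l<) u) _

    module _ (E-injective : ∀ k → k ≤ m → Injective _≡_ _≡_ (E k)) where

      cell-injective : ∀ k l → k < suc m → l < suc m ∸ k → Injective _≡_ _≡_ (cell k l)
      cell-injective k l k< l< eq = digits-injective _ _ _
        (cong₂ _,_ (cong₂ _,_ (E-injective k k≤m (cong left eq))
                              (E-injective l (l≤m k l≤m-k) (cong (λ t → left (right t)) eq)))
                   (E-injective _ (rest≤m k l) (cong (λ t → right (right t)) eq)))
        where
        k≤m : k ≤ m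
        k≤m = proj₁ (bounds k< l<)
        l≤m-k : l ≤ m ∸ k
        l≤m-k = proj₂ (bounds k< l<)

      -- Within a layer, the block l is the size of the middle subtree.
      layer-injective : ∀ k → k < suc m → Injective _≡_ _≡_ (layer k)
      layer-injective k k< = glue-injective (suc m ∸ k) (Block r m k) (cell k) (λ t → size (left (right t)))
        (λ l v l< → E-size l (l≤m k (proj₂ (bounds k< l<))) _)
        (λ l l< → cell-injective k l k< l<)

      -- Across layers, the block k is the size of the left subtree.
      layer-label : ∀ k u → k < suc m → size (left (layer k u)) ≡ k
      layer-label k u k< = glue-preserves (suc m ∸ k) (Block r m k) (cell k) (λ t → size (left t) ≡ k)
        (λ l v l< → E-size k (s≤s⁻¹ k<) _) u

      step-injective : Injective _≡_ _≡_ step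
      step-injective eq = subst-injective (r-recursion m)
        (glue-injective (suc m) (Inner r m) layer (λ t → size (left t)) layer-label layer-injective eq)

-- The encoding, by recursion on a fuel bound f ≥ n.
encodeWith : ℕ → (n : ℕ) → Fin (r n) → Tree
encodeWith zero    _             _ = leaf
encodeWith (suc f) zero          _ = leaf
encodeWith (suc f) (suc zero)    _ = node leaf leaf
encodeWith (suc f) (suc (suc m)) x = Step.step m (encodeWith f) x

encodeWith-size : ∀ f n → n ≤ f → ∀ x → size (encodeWith f n x) ≡ n
encodeWith-size zero    zero          _         _ = refl
encodeWith-size (suc f) zero          _         _ = refl
encodeWith-size (suc f) (suc zero)    _         _ = refl
encodeWith-size (suc f) (suc (suc m)) (s≤s m<f) x =
  Step.step-size m (encodeWith f) (λ k k≤m → encodeWith-size f k (≤-trans k≤m (<⇒≤ m<f))) x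

encodeWith-injective : ∀ f n → n ≤ f → Injective _≡_ _≡_ (encodeWith f n)
encodeWith-injective f zero _ {0F} {0F} _ = refl
encodeWith-injective (suc f) (suc zero) _ {0F} {0F} _ = refl
encodeWith-injective (suc f) (suc (suc m)) (s≤s m<f) =
  Step.step-injective m (encodeWith f) (λ k k≤m → encodeWith-size f k (≤-trans k≤m (<⇒≤ m<f)))
                      (λ k k≤m → encodeWith-injective f k (≤-trans k≤m (<⇒≤ m<f)))

encode : (n : ℕ) → Fin (r n) → Tree
encode n = encodeWith n n

encode-size : ∀ n x → size (encode n x) ≡ n
encode-size n = encodeWith-size n n ≤-refl

encode-injective : ∀ n → Injective _≡_ _≡_ (encode n)
encode-injective n = encodeWith-injective n n ≤-refl

-- Permutations of {0, …, n-1} are handled as maps ℕ → ℕ; f and g agree below n: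
AgreeBelow : ℕ → (ℕ → ℕ) → (ℕ → ℕ) → Set
AgreeBelow n f g = ∀ i → i < n → f i ≡ g i

Avoids132 : ℕ → (ℕ → ℕ) → Set
Avoids132 n f = ∀ {x y z} → x < y → y < z → z < n → f x < f z → f z < f y → ⊥

record Perm132 (n : ℕ) : Set where
  field
    to from    : ℕ → ℕ
    to-bound   : ∀ i → i < n → to i < n
    from-bound : ∀ v → v < n → from v < n
    from-to    : ∀ i → i < n → from (to i) ≡ i
    to-from    : ∀ v → v < n → to (from v) ≡ v
    avoids     : Avoids132 n to

open Perm132

from-agree : ∀ {n n′} (P : Perm132 n) (Q : Perm132 n′) → n ≡ n′ →
  AgreeBelow n (to P) (to Q) → AgreeBelow n (from P) (from Q)
from-agree {n} P Q refl agree v v<n = begin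
  from P v                    ≡⟨ sym (from-to Q (from P v) Pv<n) ⟩
  from Q (to Q (from P v))    ≡⟨ cong (from Q) (sym (agree (from P v) Pv<n)) ⟩
  from Q (to P (from P v))    ≡⟨ cong (from Q) (to-from P v v<n) ⟩
  from Q v                    ∎
  where
  open ≡-Reasoning
  Pv<n : from P v < n
  Pv<n = from-bound P v v<n

skewTo : (a b : ℕ) (fa fb : ℕ → ℕ) → ℕ → ℕ
skewTo a b fa fb i with i <? a
... | yes _ = b + fa i
... | no _ with a <? i
...   | yes _ = fb (i ∸ suc a)
...   | no _  = a + b

unshift : (a : ℕ) (ga : ℕ → ℕ) → ℕ → ℕ
unshift a ga w with w <? a
... | yes _ = ga w
... | no _  = a

skewFrom : (a b : ℕ) (ga gb : ℕ → ℕ) → ℕ → ℕ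
skewFrom a b ga gb v with v <? b
... | yes _ = suc a + gb v
... | no _  = unshift a ga (v ∸ b)

module _ (a b : ℕ) (fa fb : ℕ → ℕ) where

  skewTo-left : ∀ {i} → i < a → skewTo a b fa fb i ≡ b + fa i
  skewTo-left {i} i<a with i <? a
  ... | yes _  = refl
  ... | no i≮a = ⊥-elim (i≮a i<a)

  skewTo-root : skewTo a b fa fb a ≡ a + b
  skewTo-root with a <? a
  ... | yes a<a = ⊥-elim (<-irrefl refl a<a)
  ... | no _ with a <? a
  ...   | yes a<a = ⊥-elim (<-irrefl refl a<a)
  ...   | no _    = refl

  skewTo-right : ∀ j → skewTo a b fa fb (suc a + j) ≡ fb j
  skewTo-right j with suc a + j <? a
  ... | yes i<a = ⊥-elim (<⇒≱ i<a (m≤n⇒m≤1+n (m≤m+n a j)))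
  ... | no _ with a <? suc a + j
  ...   | yes _  = cong fb (m+n∸m≡n (suc a) j)
  ...   | no a≮i = ⊥-elim (a≮i (s≤s (m≤m+n a j)))

module _ (a b : ℕ) (ga gb : ℕ → ℕ) where

  skewFrom-low : ∀ {v} → v < b → skewFrom a b ga gb v ≡ suc a + gb v
  skewFrom-low {v} v<b with v <? b
  ... | yes _  = refl
  ... | no v≮b = ⊥-elim (v≮b v<b)

  skewFrom-high : ∀ w → skewFrom a b ga gb (b + w) ≡ unshift a ga w
  skewFrom-high w with b + w <? b
  ... | yes v<b = ⊥-elim (<⇒≱ v<b (m≤m+n b w))
  ... | no _    = cong (unshift a ga) (m+n∸m≡n b w)

unshift-left : ∀ {a} ga {w} → w < a → unshift a ga w ≡ ga w
unshift-left {a} ga {w} w<a with w <? a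
... | yes _  = refl
... | no w≮a = ⊥-elim (w≮a w<a)

unshift-root : ∀ a ga → unshift a ga a ≡ a
unshift-root a ga with a <? a
... | yes a<a = ⊥-elim (<-irrefl refl a<a)
... | no _    = refl

data Position (a : ℕ) : ℕ → Set where
  inLeft  : ∀ {i} → i < a → Position a i
  atRoot  : Position a a
  inRight : ∀ j → Position a (suc a + j)

position : ∀ a i → Position a i
position a i with <-cmp i a
... | tri< i<a _ _  = inLeft i<a
... | tri≈ _ refl _ = atRoot
... | tri> _ _ a<i  = subst (Position a) (m+[n∸m]≡n a<i) (inRight (i ∸ suc a))

data Value (a b : ℕ) : ℕ → Set where
  low  : ∀ {v} → v < b → Value a b v
  high : ∀ {w} → w < a → Value a b (b + w)
  top  : Value a b (b + a)

value : ∀ a b v → v < suc (a + b) → Value a b v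
value a b v v<n with v <? b
... | yes v<b = low v<b
... | no v≮b  = subst (Value a b) (m+[n∸m]≡n (≮⇒≥ v≮b)) (shifted (v ∸ b) w≤a)
  where
  w≤a : v ∸ b ≤ a
  w≤a = m≤n+o⇒m∸n≤o v b (subst (v ≤_) (+-comm a b) (s≤s⁻¹ v<n))
  shifted : ∀ w → w ≤ a → Value a b (b + w)
  shifted w w≤a with m≤n⇒m<n∨m≡n w≤a
  ... | inj₁ w<a  = high w<a
  ... | inj₂ refl = top

module Skew {a b : ℕ} (A : Perm132 a) (B : Perm132 b) where

  to′ : ℕ → ℕ
  to′ = skewTo a b (to A) (to B)

  from′ : ℕ → ℕ
  from′ = skewFrom a b (from A) (from B)

  to′-high : ∀ {i} → i ≤ a → b ≤ to′ i
  to′-high {i} i≤a with m≤n⇒m<n∨m≡n i≤a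
  ... | inj₁ i<a  = subst (b ≤_) (sym (skewTo-left a b _ _ i<a)) (m≤m+n b _)
  ... | inj₂ refl = subst (b ≤_) (sym (skewTo-root a b _ _)) (m≤n+m b a)

  to′-low : ∀ {j} → j < b → to′ (suc a + j) < b
  to′-low {j} j<b = subst (_< b) (sym (skewTo-right a b _ _ j)) (to-bound B j j<b)

  private
    shifted< : ∀ {x} → x < a → b + x < suc (a + b)
    shifted< {x} x<a = m≤n⇒m≤1+n (subst (b + x <_) (+-comm b a) (+-monoʳ-< b x<a))

    below< : ∀ {v} → v < b → v < suc (a + b)
    below< v<b = m≤n⇒m≤1+n (≤-trans v<b (m≤n+m b a))

    right< : ∀ {j} → suc a + j < suc (a + b) → j < b
    right< {j} p = +-cancelˡ-< (suc a) j b p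

  to′-bound : ∀ i → i < suc (a + b) → to′ i < suc (a + b)
  to′-bound i i<n with position a i
  ... | inLeft i<a = subst (_< suc (a + b)) (sym (skewTo-left a b _ _ i<a)) (shifted< (to-bound A i i<a))
  ... | atRoot     = subst (_< suc (a + b)) (sym (skewTo-root a b _ _)) (n<1+n (a + b))
  ... | inRight j  = below< (to′-low (right< i<n))

  from′-bound : ∀ v → v < suc (a + b) → from′ v < suc (a + b)
  from′-bound v v<n with value a b v v<n
  ... | low v<b = subst (_< suc (a + b)) (sym (skewFrom-low a b _ _ v<b))
                        (s≤s (+-monoʳ-< a (from-bound B v v<b)))
  ... | high {w} w<a = subst (_< suc (a + b)) (sym (trans (skewFrom-high a b _ _ w) (unshift-left _ w<a)))
                             (m≤n⇒m≤1+n (≤-trans (from-bound A w w<a) (m≤m+n a b)))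
  ... | top = subst (_< suc (a + b)) (sym (trans (skewFrom-high a b _ _ a) (unshift-root a _)))
                    (s≤s (m≤m+n a b))

  from′-root : from′ (a + b) ≡ a
  from′-root = begin
    from′ (a + b)          ≡⟨ cong from′ (+-comm a b) ⟩
    from′ (b + a)          ≡⟨ skewFrom-high a b _ _ a ⟩
    unshift a (from A) a   ≡⟨ unshift-root a _ ⟩
    a                      ∎
    where open ≡-Reasoning

  from′-to′ : ∀ i → i < suc (a + b) → from′ (to′ i) ≡ i
  from′-to′ i i<n with position a i
  ... | inLeft i<a = begin
    from′ (to′ i)                       ≡⟨ cong from′ (skewTo-left a b _ _ i<a) ⟩
    from′ (b + to A i)                  ≡⟨ skewFrom-high a b _ _ (to A i) ⟩
    unshift a (from A) (to A i)         ≡⟨ unshift-left _ (to-bound A i i<a) ⟩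
    from A (to A i)                     ≡⟨ from-to A i i<a ⟩
    i                                   ∎
    where open ≡-Reasoning
  ... | atRoot = trans (cong from′ (skewTo-root a b _ _)) from′-root
  ... | inRight j = begin
    from′ (to′ (suc a + j))             ≡⟨ cong from′ (skewTo-right a b _ _ j) ⟩
    from′ (to B j)                      ≡⟨ skewFrom-low a b _ _ (to-bound B j (right< i<n)) ⟩
    suc a + from B (to B j)             ≡⟨ cong (suc a +_) (from-to B j (right< i<n)) ⟩
    suc a + j                           ∎
    where open ≡-Reasoning

  to′-from′ : ∀ v → v < suc (a + b) → to′ (from′ v) ≡ v
  to′-from′ v v<n with value a b v v<n
  ... | low v<b = begin
    to′ (from′ v)                       ≡⟨ cong to′ (skewFrom-low a b _ _ v<b) ⟩
    to′ (suc a + from B v)              ≡⟨ skewTo-right a b _ _ (from B v) ⟩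
    to B (from B v)                     ≡⟨ to-from B v v<b ⟩
    v                                   ∎
    where open ≡-Reasoning
  ... | high {w} w<a = begin
    to′ (from′ (b + w))                 ≡⟨ cong to′ (trans (skewFrom-high a b _ _ w) (unshift-left _ w<a)) ⟩
    to′ (from A w)                      ≡⟨ skewTo-left a b _ _ (from-bound A w w<a) ⟩
    b + to A (from A w)                 ≡⟨ cong (b +_) (to-from A w w<a) ⟩
    b + w                               ∎
    where open ≡-Reasoning
  ... | top = begin
    to′ (from′ (b + a))                 ≡⟨ cong to′ (trans (sym (cong from′ (+-comm a b))) from′-root) ⟩
    to′ a                               ≡⟨ skewTo-root a b _ _ ⟩
    a + b                               ≡⟨ +-comm a b ⟩
    b + a                               ∎
    where open ≡-Reasoning

  -- A 132 inside α or β is excluded by induction; one meeting the root has the root as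
  -- its '3' (impossible: nothing exceeds it) or its '2' (impossible: the '1' left of it
  -- is above b, the root's '2' right of it below b).
  to′-avoids : Avoids132 (suc (a + b)) to′
  to′-avoids {x} {y} {z} x<y y<z z<n fx<fz fz<fy with position a z
  ... | inLeft z<a = avoids A x<y y<z z<a
        (+-cancelˡ-< b _ _ (subst₂ _<_ (skewTo-left a b _ _ x<a) (skewTo-left a b _ _ z<a) fx<fz))
        (+-cancelˡ-< b _ _ (subst₂ _<_ (skewTo-left a b _ _ z<a) (skewTo-left a b _ _ y<a) fz<fy))
    where
    y<a : y < a
    y<a = <-trans y<z z<a
    x<a : x < a
    x<a = <-trans x<y y<a
  ... | atRoot = <⇒≱ fz<fy (subst (to′ y ≤_) (sym (skewTo-root a b _ _))
                                  (s≤s⁻¹ (to′-bound y (<-trans y<z z<n))))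
  ... | inRight j with position a x
  ...   | inLeft x<a = <-asym fx<fz (<-≤-trans (to′-low (right< z<n)) (to′-high (<⇒≤ x<a)))
  ...   | atRoot     = <-asym fx<fz (<-≤-trans (to′-low (right< z<n)) (to′-high ≤-refl))
  ...   | inRight jx with position a y
  ...     | inLeft y<a = <-asym y<a (<-trans (s≤s (m≤m+n a jx)) x<y)
  ...     | atRoot     = <-irrefl refl (<-trans (s≤s (m≤m+n a jx)) x<y)
  ...     | inRight jy = avoids B (+-cancelˡ-< (suc a) jx jy x<y) (+-cancelˡ-< (suc a) jy j y<z) (right< z<n)
        (subst₂ _<_ (skewTo-right a b _ _ jx) (skewTo-right a b _ _ j) fx<fz)
        (subst₂ _<_ (skewTo-right a b _ _ j) (skewTo-right a b _ _ jy) fz<fy)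

skew : ∀ {a b} → Perm132 a → Perm132 b → Perm132 (suc (a + b))
skew A B = record
  { to = to′ ; from = from′ ; to-bound = to′-bound ; from-bound = from′-bound
  ; from-to = from′-to′ ; to-from = to′-from′ ; avoids = to′-avoids }
  where open Skew A B

-- A skew sum determines its summands: the root sits at the preimage of the maximum,
-- and the two blocks are read back from the two sides.
skew-injective : ∀ {a b a′ b′} (A : Perm132 a) (B : Perm132 b) (A′ : Perm132 a′) (B′ : Perm132 b′) →
  a + b ≡ a′ + b′ → AgreeBelow (suc (a + b)) (to (skew A B)) (to (skew A′ B′)) →
  a ≡ a′ × b ≡ b′ × AgreeBelow a (to A) (to A′) × AgreeBelow b (to B) (to B′)
skew-injective {a} {b} {a′} {b′} A B A′ B′ sum-eq agree =
  a≡a′ , b≡b′ , blocks a≡a′ b≡b′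
  where
  a≡a′ : a ≡ a′
  a≡a′ = begin
    a                              ≡⟨ sym (Skew.from′-root A B) ⟩
    from (skew A B) (a + b)        ≡⟨ from-agree (skew A B) (skew A′ B′) (cong suc sum-eq) agree (a + b) (n<1+n _) ⟩
    from (skew A′ B′) (a + b)      ≡⟨ cong (from (skew A′ B′)) sum-eq ⟩
    from (skew A′ B′) (a′ + b′)    ≡⟨ Skew.from′-root A′ B′ ⟩
    a′                             ∎
    where open ≡-Reasoning

  b≡b′ : b ≡ b′
  b≡b′ = +-cancelˡ-≡ a b b′ (trans sum-eq (cong (_+ b′) (sym a≡a′)))

  blocks : a ≡ a′ → b ≡ b′ → AgreeBelow a (to A) (to A′) × AgreeBelow b (to B) (to B′)
  blocks refl refl =
    (λ i i<a → +-cancelˡ-≡ b _ _ (begin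
       b + to A i               ≡⟨ sym (skewTo-left a b _ _ i<a) ⟩
       to (skew A B) i          ≡⟨ agree i (m≤n⇒m≤1+n (≤-trans i<a (m≤m+n a b))) ⟩
       to (skew A′ B′) i        ≡⟨ skewTo-left a b _ _ i<a ⟩
       b + to A′ i              ∎)) ,
    (λ j j<b → begin
       to B j                   ≡⟨ sym (skewTo-right a b _ _ j) ⟩
       to (skew A B) (suc a + j) ≡⟨ agree (suc a + j) (s≤s (+-monoʳ-< a j<b)) ⟩
       to (skew A′ B′) (suc a + j) ≡⟨ skewTo-right a b _ _ j ⟩
       to B′ j                  ∎)
    where open ≡-Reasoning

empty : Perm132 0
empty = record
  { to = λ i → i ; from = λ v → v ; to-bound = λ _ () ; from-bound = λ _ ()
  ; from-to = λ _ () ; to-from = λ _ () ; avoids = λ _ _ () }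

treePerm : (t : Tree) → Perm132 (size t)
treePerm leaf       = empty
treePerm (node α β) = skew (treePerm α) (treePerm β)

treePerm-injective : ∀ {n} t t′ → size t ≡ n → size t′ ≡ n →
  AgreeBelow n (to (treePerm t)) (to (treePerm t′)) → t ≡ t′
treePerm-injective leaf       leaf         _    _  _ = refl
treePerm-injective leaf       (node _ _)   refl ()
treePerm-injective (node _ _) leaf         refl ()
treePerm-injective (node α β) (node α′ β′) refl e′ agree
  with skew-injective (treePerm α) (treePerm β) (treePerm α′) (treePerm β′) (sym (suc-injective e′)) agree
... | eα , eβ , agree-α , agree-β =
  cong₂ node (treePerm-injective α α′ refl (sym eα) agree-α) (treePerm-injective β β′ refl (sym eβ) agree-β)

record Occurrence132 {k : ℕ} (σ : Fin k → Fin k) : Set where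
  constructor occurrence
  field
    x y z : Fin k
    x<y   : toℕ x < toℕ y
    y<z   : toℕ y < toℕ z
    σx<σz : toℕ (σ x) < toℕ (σ z)
    σz<σy : toℕ (σ z) < toℕ (σ y)

occurrence-transfer : ∀ {n k} {π : Fin n → Fin n} {σ : Fin k → Fin k} →
  Contains π σ → Occurrence132 σ → Occurrence132 π
occurrence-transfer (ι , increasing , iso) (occurrence x y z x<y y<z σx<σz σz<σy) =
  occurrence (ι x) (ι y) (ι z) (increasing x y x<y) (increasing y z y<z)
             (Equivalence.from (iso x z) σx<σz) (Equivalence.from (iso z y) σz<σy)

2143-has-132 : Occurrence132 p2143
2143-has-132 = occurrence 1F 2F 3F (s≤s (s≤s z≤n)) (s≤s (s≤s (s≤s z≤n))) (s≤s z≤n) (s≤s (s≤s (s≤s z≤n)))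

2413-has-132 : Occurrence132 p2413
2413-has-132 = occurrence 0F 1F 3F (s≤s z≤n) (s≤s (s≤s z≤n)) (s≤s (s≤s z≤n)) (s≤s (s≤s (s≤s z≤n)))

3142-has-132 : Occurrence132 p3142
3142-has-132 = occurrence 1F 2F 3F (s≤s (s≤s z≤n)) (s≤s (s≤s (s≤s z≤n))) (s≤s z≤n) (s≤s (s≤s z≤n))

module Realise {n : ℕ} (P : Perm132 n) where

  toFin : Fin n → Fin n
  toFin i = fromℕ< (to-bound P (toℕ i) (toℕ<n i))

  fromFin : Fin n → Fin n
  fromFin v = fromℕ< (from-bound P (toℕ v) (toℕ<n v))

  toℕ-toFin : ∀ i → toℕ (toFin i) ≡ to P (toℕ i)
  toℕ-toFin i = toℕ-fromℕ< _

  toℕ-fromFin : ∀ v → toℕ (fromFin v) ≡ from P (toℕ v)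
  toℕ-fromFin v = toℕ-fromℕ< _

  perm : Perm n
  perm = permutation toFin fromFin
    (λ v → toℕ-injective (trans (toℕ-toFin (fromFin v))
             (trans (cong (to P) (toℕ-fromFin v)) (to-from P (toℕ v) (toℕ<n v)))))
    (λ i → toℕ-injective (trans (toℕ-fromFin (toFin i))
             (trans (cong (from P) (toℕ-toFin i)) (from-to P (toℕ i) (toℕ<n i)))))

  no-132 : Occurrence132 toFin → ⊥
  no-132 (occurrence x y z x<y y<z πx<πz πz<πy) =
    avoids P x<y y<z (toℕ<n z)
      (subst₂ _<_ (toℕ-toFin x) (toℕ-toFin z) πx<πz) (subst₂ _<_ (toℕ-toFin z) (toℕ-toFin y) πz<πy)

  avoiding : AvoidingPerm n
  avoiding = perm , avoid 2143-has-132 , avoid 2413-has-132 , avoid 3142-has-132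
    where
    avoid : ∀ {σ : Fin 4 → Fin 4} → Occurrence132 σ → Avoids toFin σ
    avoid has-132 contains = no-132 (occurrence-transfer contains has-132)

realise : ∀ {m n} → Perm132 m → m ≡ n → AvoidingPerm n
realise P refl = Realise.avoiding P

realise-agree : ∀ {m m′ n} (P : Perm132 m) (Q : Perm132 m′) (e : m ≡ n) (e′ : m′ ≡ n) →
  SamePerm (realise P e) (realise Q e′) → AgreeBelow n (to P) (to Q)
realise-agree P Q refl refl same i i<n = begin
  to P i                              ≡⟨ cong (to P) (sym (toℕ-fromℕ< i<n)) ⟩
  to P (toℕ (fromℕ< i<n))             ≡⟨ sym (Realise.toℕ-toFin P _) ⟩
  toℕ (Realise.toFin P (fromℕ< i<n))  ≡⟨ cong toℕ (same (fromℕ< i<n)) ⟩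
  toℕ (Realise.toFin Q (fromℕ< i<n))  ≡⟨ Realise.toℕ-toFin Q _ ⟩
  to Q (toℕ (fromℕ< i<n))             ≡⟨ cong (to Q) (toℕ-fromℕ< i<n) ⟩
  to Q i                              ∎
  where open ≡-Reasoning

proposition4 : (n : ℕ) →
    Σ (Fin (r n) → AvoidingPerm n) λ f →
      ∀ x y → SamePerm (f x) (f y) → x ≡ y
proposition4 n = permutationOf , permutationOf-injective
  where
  permutationOf : Fin (r n) → AvoidingPerm n
  permutationOf x = realise (treePerm (encode n x)) (encode-size n x)

  permutationOf-injective : ∀ x y → SamePerm (permutationOf x) (permutationOf y) → x ≡ y
  permutationOf-injective x y same = encode-injective n
    (treePerm-injective (encode n x) (encode n y) (encode-size n x) (encode-size n y)
      (realise-agree (treePerm (encode n x)) (treePerm (encode n y)) (encode-size n x) (encode-size n y) same))
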